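{- Fix $T$ with $1<T<\tfrac43$, let $n\ge 3$, and let $C_0,C_1,\dots$ be a sequence of configurations produced by the PD process on the $n$-vertex cycle. For every $t$: (1) $C_t$ contains no weak defectors; (2) a weak cooperator in $C_t$ is either isolated, or has a neighbour that is either an isolated defector, or has a cooperator neighbour that has a defector neighbour; (3) $C_{t+1}$ contains no isolated defectors.
   Context: A configuration on a graph $G=(V,E)$ is a map $C:V\to\{0,1\}$; $1$ means cooperator, $0$ means defector. An isolated cooperator (resp. isolated defector) is a cooperator (resp. defector) all of whose neighbours have the opposite strategy. The pay-off $f(a,b)$ to a player with strategy $a$ against strategy $b$ is $f(0,0)=0$, $f(0,1)=T$, $f(1,0)=0$, $f(1,1)=1$. The score of $v$ is $s(v)=\sum_{x\in N(v)} f(C(v),C(x))$. The most successful neighbours of $v$ are the vertices of $N[v]$ of maximum score (defectors taken as most successful in case of a tie between a cooperator and a defector). A vertex is weak if its strategy differs from that of its most successful neighbours; updating a vertex changes its strategy if it is currently weak and does nothing otherwise. PD process: given $C_t$, let $W_t$ be the set of weak vertices; if $W_t=\emptyset$ the process stops. Otherwise a uniformly random ordering of $W_t$ is chosen and the vertices are updated one at a time in that order, each with respect to the current configuration, producing $C_{t+1}$. -}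

module Defs where

open import Data.Bool using (Bool; true; false; _∧_; not; if_then_else_) renaming (_≟_ to _≟ᵇ_)
open import Data.Nat using (ℕ; suc) renaming (_+_ to _+ℕ_)
open import Data.Nat.DivMod using (_mod_)
open import Data.Fin using (Fin; toℕ)
open import Data.Fin.Properties using () renaming (_≟_ to _≟ᶠ_)
open import Data.Integer using (+_)
open import Data.Rational using (ℚ; 0ℚ; 1ℚ; _+_; _≤ᵇ_)
open import Data.List using (List; []; _∷_)
open import Data.Bool.ListAction using (any; all)
open import Data.List.Membership.Propositional using (_∈_)
open import Data.List.Relation.Unary.Unique.Propositional using (Unique)
open import Data.Product using (Σ; ∃; _×_)
open import Relation.Binary.PropositionalEquality using (_≡_; _≢_)
open import Relation.Nullary.Decidable using (⌊_⌋)
open import Function.Bundles using (_⇔_)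

-- Strategies: true = cooperator (1), false = defector (0).
Config : ℕ → Set
Config n = Fin n → Bool

next : ∀ {n} → Fin n → Fin n
next {suc m} i = (toℕ i +ℕ 1) mod (suc m)

prev : ∀ {n} → Fin n → Fin n
prev {suc m} i = (toℕ i +ℕ m) mod (suc m)

N : ∀ {n} → Fin n → List (Fin n)
N v = prev v ∷ next v ∷ []

N[_] : ∀ {n} → Fin n → List (Fin n)
N[ v ] = v ∷ N v

payoff : ℚ → Bool → Bool → ℚ
payoff T false false = 0ℚ
payoff T false true  = T
payoff T true  false = 0ℚ
payoff T true  true  = 1ℚ

sumℚ : List ℚ → ℚ
sumℚ []       = 0ℚ
sumℚ (x ∷ xs) = x + sumℚ xs

mapL : ∀ {A B : Set} → (A → B) → List A → List B
mapL f []       = []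
mapL f (x ∷ xs) = f x ∷ mapL f xs

score : ℚ → ∀ {n} → Config n → Fin n → ℚ
score T C v = sumℚ (mapL (λ x → payoff T (C v) (C x)) (N v))

isMax : ℚ → ∀ {n} → Config n → Fin n → Fin n → Bool
isMax T C v u = all (λ w → score T C w ≤ᵇ score T C u) N[ v ]

-- Strategy of the most successful neighbours of v: defector (false) if some
-- defector of N[v] has maximum score (defectors win ties), cooperator otherwise.
bestStrategy : ℚ → ∀ {n} → Config n → Fin n → Bool
bestStrategy T C v = not (any (λ u → not (C u) ∧ isMax T C v u) N[ v ])

weakᵇ : ℚ → ∀ {n} → Config n → Fin n → Bool
weakᵇ T C v = not (⌊ C v ≟ᵇ bestStrategy T C v ⌋)

Weak : ℚ → ∀ {n} → Config n → Fin n → Set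
Weak T C v = C v ≢ bestStrategy T C v

update : ℚ → ∀ {n} → Config n → Fin n → Config n
update T C v w = if weakᵇ T C v ∧ ⌊ v ≟ᶠ w ⌋ then not (C w) else C w

updateAll : ℚ → ∀ {n} → Config n → List (Fin n) → Config n
updateAll T C []       = C
updateAll T C (v ∷ vs) = updateAll T (update T C v) vs

-- One round of the PD process: W_t is nonempty and C' is obtained by updating
-- the vertices of W_t in some ordering (every ordering has positive probability).
PDStep : ℚ → ∀ {n} → Config n → Config n → Set
PDStep T {n} C C' =
  (∃ λ v → Weak T C v) ×
  Σ (List (Fin n)) (λ ord →
    Unique ord × (∀ v → (v ∈ ord) ⇔ Weak T C v) × (∀ w → C' w ≡ updateAll T C ord w))

Adj : ∀ {n} → Fin n → Fin n → Set
Adj v u = u ∈ N v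

IsolatedCooperator : ∀ {n} → Config n → Fin n → Set
IsolatedCooperator C v = C v ≡ true × (∀ u → Adj v u → C u ≡ false)

IsolatedDefector : ∀ {n} → Config n → Fin n → Set
IsolatedDefector C v = C v ≡ false × (∀ u → Adj v u → C u ≡ true)

-- For T > 1 a defector next to a cooperator scores at least T, while a
-- cooperator next to a defector scores at most 1; so the most successful
-- vertex of N[v] is a defector whenever v defects, and defectors are never
-- weak.  A weak cooperator v thus imitates a most successful defector
-- neighbour d.  If v has a cooperator neighbour u all of whose neighbours
-- cooperate, then s(d) ≥ s(u) = 2 > T, which forces d to be isolated.
-- In a round of updates defectors stay defectors, and a new defector is a
-- weak cooperator, hence adjacent to a defector.  An isolated defector scores
-- 2T, the maximum possible score, so both its neighbours are weak and are
-- scheduled in the round; the first of them to be updated defects next to it.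

module Submission where

open import Defs
open import Data.Bool using (Bool; true; false; not; _∧_) renaming (T to True; _≟_ to _≟ᵇ_)
open import Data.Bool.Properties using (¬-not; not-¬; not-injective; T-≡; T-not-≡; T-∧)
open import Data.Nat using (ℕ; suc; _≤_; _<_; NonZero) renaming (_+_ to _+ℕ_)
import Data.Nat.Properties as ℕ
open import Data.Nat.DivMod using (_%_; _mod_; %-distribˡ-+; m%n%n≡m%n; [m+n]%n≡m%n; m<n⇒m%n≡m; m%n<n)
open import Data.Fin using (Fin; toℕ) renaming (_≟_ to _≟ᶠ_)
open import Data.Fin.Properties using (toℕ-injective; toℕ-fromℕ<; toℕ<n)
open import Data.Integer using (+_)
open import Data.Rational using (ℚ; 0ℚ; 1ℚ; _/_; _+_; _≤ᵇ_; _<?_) renaming (_≤_ to _≤ℚ_; _<_ to _<ℚ_)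
open import Data.Rational.Properties
  using (module ≤-Reasoning; ≤-refl; ≤-trans; <⇒≤; <-irrefl; <-≤-trans; <-trans; ≤ᵇ⇒≤; ≤⇒≤ᵇ; ≤-decTotalOrder; nonNegative⁻¹)
open import Data.Rational.Properties
  using (+-mono-≤; +-monoʳ-≤; +-identityˡ; +-identityʳ; +-comm)
open import Data.List using (List; []; _∷_)
open import Data.List.Relation.Unary.Any using (here; there; any?)
import Data.List.Relation.Unary.All as All
open import Data.List.Relation.Unary.Any.Properties using (any⁺; any⁻)
open import Data.List.Relation.Unary.All.Properties using (all⁺; all⁻)
open import Data.List.Membership.Propositional using (_∈_; find; lose)
import Data.List.Membership.DecPropositional
open import Data.List.Relation.Binary.Subset.Propositional using (_⊆_)
import Data.List.Extrema
open import Data.Product using (∃; _×_; _,_; proj₁)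
open import Data.Sum using (_⊎_; inj₁; inj₂; [_,_]′)
open import Data.Empty using (⊥-elim)
open import Function using (_∘_; _$_)
open import Function.Bundles using (Equivalence; _⇔_)
open import Relation.Binary.Bundles using (DecTotalOrder)
open import Relation.Binary.Definitions using (DecidableEquality)
open import Relation.Nullary using (¬_; yes; no)
open import Relation.Nullary.Decidable using (toWitness)
open import Relation.Binary.PropositionalEquality using (_≡_; _≢_; refl; sym; trans; cong; subst; module ≡-Reasoning)

toℕ-mod : ∀ k d .{{_ : NonZero d}} → toℕ (k mod d) ≡ k % d
toℕ-mod k d = toℕ-fromℕ< (m%n<n k d)

[m%d+n]%d≡[m+n]%d : ∀ m n d .{{_ : NonZero d}} → (m % d +ℕ n) % d ≡ (m +ℕ n) % d
[m%d+n]%d≡[m+n]%d m n d = begin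
  (m % d +ℕ n) % d          ≡⟨ %-distribˡ-+ (m % d) n d ⟩
  (m % d % d +ℕ n % d) % d  ≡⟨ cong (λ r → (r +ℕ n % d) % d) (m%n%n≡m%n m d) ⟩
  (m % d +ℕ n % d) % d      ≡⟨ %-distribˡ-+ m n d ⟨
  (m +ℕ n) % d              ∎
  where open ≡-Reasoning

-- next and prev are definitionally rotate 1 and rotate m on Fin (suc m).
rotate : ∀ {m} → ℕ → Fin (suc m) → Fin (suc m)
rotate {m} k i = (toℕ i +ℕ k) mod suc m

rotate-rotate : ∀ {m} k l (i : Fin (suc m)) → rotate k (rotate l i) ≡ rotate (l +ℕ k) i
rotate-rotate {m} k l i = toℕ-injective (begin
  toℕ (rotate k (rotate l i))         ≡⟨ toℕ-mod (toℕ (rotate l i) +ℕ k) (suc m) ⟩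
  (toℕ (rotate l i) +ℕ k) % suc m     ≡⟨ cong (λ r → (r +ℕ k) % suc m) (toℕ-mod (toℕ i +ℕ l) (suc m)) ⟩
  ((toℕ i +ℕ l) % suc m +ℕ k) % suc m ≡⟨ [m%d+n]%d≡[m+n]%d (toℕ i +ℕ l) k (suc m) ⟩
  (toℕ i +ℕ l +ℕ k) % suc m           ≡⟨ cong (_% suc m) (ℕ.+-assoc (toℕ i) l k) ⟩
  (toℕ i +ℕ (l +ℕ k)) % suc m         ≡⟨ toℕ-mod (toℕ i +ℕ (l +ℕ k)) (suc m) ⟨
  toℕ (rotate (l +ℕ k) i)             ∎)
  where open ≡-Reasoning

rotate-full : ∀ {m} (i : Fin (suc m)) → rotate (suc m) i ≡ i
rotate-full {m} i = toℕ-injective (begin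
  toℕ (rotate (suc m) i)     ≡⟨ toℕ-mod (toℕ i +ℕ suc m) (suc m) ⟩
  (toℕ i +ℕ suc m) % suc m   ≡⟨ [m+n]%n≡m%n (toℕ i) (suc m) ⟩
  toℕ i % suc m              ≡⟨ m<n⇒m%n≡m (toℕ<n i) ⟩
  toℕ i                      ∎)
  where open ≡-Reasoning

next-prev : ∀ {n} (v : Fin n) → next (prev v) ≡ v
next-prev {suc m} v =
  trans (rotate-rotate 1 m v) (trans (cong (λ k → rotate k v) (ℕ.+-comm m 1)) (rotate-full v))

prev-next : ∀ {n} (v : Fin n) → prev (next v) ≡ v
prev-next {suc m} v = trans (rotate-rotate m 1 v) (rotate-full v)

Adj-sym : ∀ {n} {v u : Fin n} → Adj v u → Adj u v
Adj-sym {v = v} (here refl)         = there (here (sym (next-prev v)))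
Adj-sym {v = v} (there (here refl)) = here (sym (prev-next v))

false≢true : false ≢ true
false≢true ()

p≤p+q : ∀ {p q} → 0ℚ ≤ℚ q → p ≤ℚ p + q
p≤p+q {p} {q} 0≤q = subst (_≤ℚ p + q) (+-identityʳ p) (+-monoʳ-≤ p 0≤q)

find-or-all-not : ∀ {A : Set} (f : A → Bool) b xs →
  (∃ λ x → x ∈ xs × f x ≡ b) ⊎ (∀ x → x ∈ xs → f x ≡ not b)
find-or-all-not f b xs with any? (λ x → f x ≟ᵇ b) xs
... | yes some = inj₁ (find some)
... | no none  = inj₂ λ x x∈ → ¬-not λ fx≡b → none (lose x∈ fx≡b)

⊆-∷⁻ : ∀ {A : Set} → DecidableEquality A → ∀ {x : A} {xs ys} → xs ⊆ x ∷ ys → x ∈ xs ⊎ xs ⊆ ys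
⊆-∷⁻ _≟_ {x} {xs} {ys} xs⊆x∷ys with Data.List.Membership.DecPropositional._∈?_ _≟_ x xs
... | yes x∈xs = inj₁ x∈xs
... | no  x∉xs = inj₂ λ u∈xs → avoid-x u∈xs (xs⊆x∷ys u∈xs)
  where
  avoid-x : ∀ {u} → u ∈ xs → u ∈ x ∷ ys → u ∈ ys
  avoid-x u∈xs (here refl) = ⊥-elim (x∉xs u∈xs)
  avoid-x u∈xs (there u∈ys) = u∈ys

module PD (T : ℚ) (1<T : 1ℚ <ℚ T) {n : ℕ} where

  0≤T : 0ℚ ≤ℚ T
  0≤T = ≤-trans (nonNegative⁻¹ 1ℚ) (<⇒≤ 1<T)

  payoff≥0 : ∀ a b → 0ℚ ≤ℚ payoff T a b
  payoff≥0 false false = ≤-refl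
  payoff≥0 false true  = 0≤T
  payoff≥0 true  false = ≤-refl
  payoff≥0 true  true  = nonNegative⁻¹ 1ℚ

  payoff≤T : ∀ a b → payoff T a b ≤ℚ T
  payoff≤T false false = 0≤T
  payoff≤T false true  = ≤-refl
  payoff≤T true  false = 0≤T
  payoff≤T true  true  = <⇒≤ 1<T

  cooperator-payoff≤1 : ∀ b → payoff T true b ≤ℚ 1ℚ
  cooperator-payoff≤1 false = nonNegative⁻¹ 1ℚ
  cooperator-payoff≤1 true  = ≤-refl

  module _ (C : Config n) where

    score-split : ∀ v → score T C v ≡ payoff T (C v) (C (prev v)) + payoff T (C v) (C (next v))
    score-split v = cong (λ q → payoff T (C v) (C (prev v)) + q) (+-identityʳ (payoff T (C v) (C (next v))))

    score-via : ∀ {v u} → Adj v u → ∃ λ u′ → score T C v ≡ payoff T (C v) (C u) + payoff T (C v) (C u′)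
    score-via {v} (here refl)         = next v , score-split v
    score-via {v} (there (here refl)) =
      prev v , trans (score-split v) (+-comm (payoff T (C v) (C (prev v))) (payoff T (C v) (C (next v))))

    score-uniform : ∀ {v b} → (∀ u → Adj v u → C u ≡ b) → score T C v ≡ payoff T (C v) b + payoff T (C v) b
    score-uniform {v} all-b
      rewrite score-split v | all-b (prev v) (here refl) | all-b (next v) (there (here refl)) = refl

    score≤T+T : ∀ v → score T C v ≤ℚ T + T
    score≤T+T v rewrite score-split v =
      +-mono-≤ (payoff≤T (C v) (C (prev v))) (payoff≤T (C v) (C (next v)))

    fully-cooperative-score : ∀ {v} → C v ≡ true → (∀ u → Adj v u → C u ≡ true) → score T C v ≡ 1ℚ + 1ℚ
    fully-cooperative-score cv all-coop rewrite score-uniform all-coop | cv = refl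

    isolatedDefector-score : ∀ {v} → IsolatedDefector C v → score T C v ≡ T + T
    isolatedDefector-score (cv , all-coop) rewrite score-uniform all-coop | cv = refl

    defector-score≥T : ∀ {v u} → C v ≡ false → Adj v u → C u ≡ true → T ≤ℚ score T C v
    defector-score≥T {v} {u} cv vu cu with score-via vu
    ... | u′ , split rewrite split | cv | cu = p≤p+q (payoff≥0 false (C u′))

    defector-score≤T : ∀ {v u} → C v ≡ false → Adj v u → C u ≡ false → score T C v ≤ℚ T
    defector-score≤T {v} {u} cv vu cu with score-via vu
    ... | u′ , split rewrite split | cv | cu | +-identityˡ (payoff T false (C u′)) = payoff≤T false (C u′)

    cooperator-score≤1 : ∀ {v u} → C v ≡ true → Adj v u → C u ≡ false → score T C v ≤ℚ 1ℚ
    cooperator-score≤1 {v} {u} cv vu cu with score-via vu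
    ... | u′ , split rewrite split | cv | cu | +-identityˡ (payoff T true (C u′)) = cooperator-payoff≤1 (C u′)

    MostSuccessful : Fin n → Fin n → Set
    MostSuccessful v u = u ∈ N[ v ] × (∀ w → w ∈ N[ v ] → score T C w ≤ℚ score T C u)

    mostSuccessful-exists : ∀ v → ∃ (MostSuccessful v)
    mostSuccessful-exists v = u , [ here , there ]′ (argmax-sel s v (N v)) , maximal
      where
      open Data.List.Extrema (DecTotalOrder.totalOrder ≤-decTotalOrder)
      s : Fin n → ℚ
      s = score T C
      u : Fin n
      u = argmax s v (N v)
      maximal : ∀ w → w ∈ N[ v ] → s w ≤ℚ s u
      maximal w (here refl) = f[⊥]≤f[argmax] {f = s} v (N v)
      maximal w (there w∈N) = All.lookup (f[xs]≤f[argmax] {f = s} v (N v)) w∈N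

    mostSuccessful-defector⇒best≡false : ∀ {v u} → MostSuccessful v u → C u ≡ false →
      bestStrategy T C v ≡ false
    mostSuccessful-defector⇒best≡false {v} {u} (u∈ , maximal) cu =
      cong not (Equivalence.to T-≡ (any⁺ (λ x → not (C x) ∧ isMax T C v x) (lose u∈ u-defects-maximally)))
      where
      u-maximal : True (isMax T C v u)
      u-maximal = all⁻ (λ w → score T C w ≤ᵇ score T C u) (All.tabulate λ {w} w∈ → ≤⇒≤ᵇ (maximal w w∈))
      u-defects-maximally : True (not (C u) ∧ isMax T C v u)
      u-defects-maximally = subst (λ b → True (not b ∧ isMax T C v u)) (sym cu) u-maximal

    best≡false⇒mostSuccessful-defector : ∀ {v} → bestStrategy T C v ≡ false →
      ∃ λ u → MostSuccessful v u × C u ≡ false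
    best≡false⇒mostSuccessful-defector {v} best≡false
      with u , u∈ , pu ← find (any⁻ (λ x → not (C x) ∧ isMax T C v x) N[ v ]
                                    (Equivalence.from T-≡ (not-injective best≡false)))
      with u-defects , u-maximal ← Equivalence.to T-∧ pu
      = u , (u∈ , maximal) , Equivalence.to T-not-≡ u-defects
      where
      maximal : ∀ w → w ∈ N[ v ] → score T C w ≤ℚ score T C u
      maximal w w∈ = ≤ᵇ⇒≤ (All.lookup (all⁺ (λ w → score T C w ≤ᵇ score T C u) N[ v ] u-maximal) w∈)

    opposite-in-N[]⇒Adj : ∀ {v u b} → C v ≡ b → C u ≡ not b → u ∈ N[ v ] → Adj v u
    opposite-in-N[]⇒Adj cv cu (here refl) = ⊥-elim (not-¬ cv cu)
    opposite-in-N[]⇒Adj cv cu (there vu)  = vu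

    mostSuccessful-of-defector-defects : ∀ {v u} → C v ≡ false → MostSuccessful v u → C u ≡ false
    mostSuccessful-of-defector-defects {v} {u} cv (u∈ , maximal) = ¬-not λ cu →
      let vu = opposite-in-N[]⇒Adj cv cu u∈ in
      <-irrefl refl $ <-≤-trans 1<T $ begin
        T             ≤⟨ defector-score≥T cv vu cu ⟩
        score T C v   ≤⟨ maximal v (here refl) ⟩
        score T C u   ≤⟨ cooperator-score≤1 cu (Adj-sym vu) cv ⟩
        1ℚ            ∎
      where open ≤-Reasoning

    defector-best≡false : ∀ {v} → C v ≡ false → bestStrategy T C v ≡ false
    defector-best≡false {v} cv =
      let u , most = mostSuccessful-exists v
      in mostSuccessful-defector⇒best≡false most (mostSuccessful-of-defector-defects cv most)

    defector-not-weak : ∀ {v} → C v ≡ false → ¬ Weak T C v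
    defector-not-weak cv weak = weak (trans cv (sym (defector-best≡false cv)))

    weak-cooperator-best≡false : ∀ {v} → C v ≡ true → Weak T C v → bestStrategy T C v ≡ false
    weak-cooperator-best≡false cv weak = trans (¬-not (weak ∘ sym)) (cong not cv)

    weak-cooperator-mostSuccessful-defector : ∀ {v} → C v ≡ true → Weak T C v →
      ∃ λ d → Adj v d × C d ≡ false × MostSuccessful v d
    weak-cooperator-mostSuccessful-defector {v} cv weak =
      let d , most , cd = best≡false⇒mostSuccessful-defector {v} (weak-cooperator-best≡false {v} cv weak)
      in d , opposite-in-N[]⇒Adj cv cd (proj₁ most) , cd , most

  module _ (T<2 : T <ℚ 1ℚ + 1ℚ) (C : Config n) where

    defector-above-T-isolated : ∀ {d} → C d ≡ false → T <ℚ score T C d → IsolatedDefector C d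
    defector-above-T-isolated {d} cd T<s with find-or-all-not C false (N d)
    ... | inj₁ (u , du , cu) = ⊥-elim (<-irrefl refl (<-≤-trans T<s (defector-score≤T C cd du cu)))
    ... | inj₂ all-coop      = cd , all-coop

    weak-cooperator-neighbourhood : ∀ {v} → C v ≡ true → Weak T C v →
      IsolatedCooperator C v
      ⊎ (∃ λ u → Adj v u × IsolatedDefector C u)
      ⊎ (∃ λ u → Adj v u × C u ≡ true × (∃ λ w → Adj u w × C w ≡ false))
    weak-cooperator-neighbourhood {v} cv weak with find-or-all-not C true (N v)
    ... | inj₂ all-defect    = inj₁ (cv , all-defect)
    ... | inj₁ (u , vu , cu) with find-or-all-not C false (N u)
    ...   | inj₁ (w , uw , cw) = inj₂ (inj₂ (u , vu , cu , w , uw , cw))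
    ...   | inj₂ all-coop      =
      let d , vd , cd , (_ , maximal) = weak-cooperator-mostSuccessful-defector C {v} cv weak
          T<sd = begin-strict
            T             <⟨ T<2 ⟩
            1ℚ + 1ℚ       ≡⟨ fully-cooperative-score C cu all-coop ⟨
            score T C u   ≤⟨ maximal u (there vu) ⟩
            score T C d   ∎
      in inj₂ (inj₁ (d , vd , defector-above-T-isolated cd T<sd))
      where open ≤-Reasoning

  isolatedDefector-neighbour-weak : ∀ (C : Config n) {v x} → IsolatedDefector C v → Adj v x →
    Weak T C x
  isolatedDefector-neighbour-weak C {v} {x} iso@(cv , all-coop) vx cx≡best =
    false≢true (trans (sym best≡false) (trans (sym cx≡best) (all-coop x vx)))
    where
    v-scores-most : ∀ w → w ∈ N[ x ] → score T C w ≤ℚ score T C v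
    v-scores-most w _ = subst (score T C w ≤ℚ_) (sym (isolatedDefector-score C iso)) (score≤T+T C w)
    best≡false : bestStrategy T C x ≡ false
    best≡false = mostSuccessful-defector⇒best≡false C {x} {v} (there (Adj-sym vx) , v-scores-most) cv

  update-cases : ∀ (D : Config n) x w →
    update T D x w ≡ D w ⊎ (w ≡ x × Weak T D x × update T D x w ≡ not (D w))
  update-cases D x w with D x ≟ᵇ bestStrategy T D x | x ≟ᶠ w
  ... | yes _   | _        = inj₁ refl
  ... | no _    | no _     = inj₁ refl
  ... | no weak | yes refl = inj₂ (refl , weak , refl)

  update-weak : ∀ (D : Config n) x → Weak T D x → update T D x x ≡ not (D x)
  update-weak D x weak with D x ≟ᵇ bestStrategy T D x | x ≟ᶠ x
  ... | yes same | _       = ⊥-elim (weak same)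
  ... | no _     | yes _   = refl
  ... | no _     | no x≢x  = ⊥-elim (x≢x refl)

  update-keeps-defector : ∀ (D : Config n) x {w} → D w ≡ false → update T D x w ≡ false
  update-keeps-defector D x {w} dw with update-cases D x w
  ... | inj₁ unchanged          = trans unchanged dw
  ... | inj₂ (refl , weak , _)  = ⊥-elim (defector-not-weak D dw weak)

  HasDefectorNeighbour : Config n → Fin n → Set
  HasDefectorNeighbour D v = ∃ λ u → Adj v u × D u ≡ false

  update-keeps-defectorNeighbour : ∀ (D : Config n) x {v} → HasDefectorNeighbour D v →
    HasDefectorNeighbour (update T D x) v
  update-keeps-defectorNeighbour D x (u , vu , du) = u , vu , update-keeps-defector D x du

  IsolationPending : Config n → List (Fin n) → Set
  IsolationPending D pending = ∀ v → D v ≡ false → HasDefectorNeighbour D v ⊎ N v ⊆ pending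

  update-keeps-isolationPending : ∀ (D : Config n) x pending →
    IsolationPending D (x ∷ pending) → IsolationPending (update T D x) pending
  update-keeps-isolationPending D x pending invariant v d′v with update-cases D x v
  ... | inj₂ (refl , weak , flipped) =
    let dx = not-injective (trans (sym flipped) d′v)
        d , xd , dd , _ = weak-cooperator-mostSuccessful-defector D {x} dx weak
    in inj₁ (update-keeps-defectorNeighbour D x (d , xd , dd))
  ... | inj₁ unchanged with invariant v (trans (sym unchanged) d′v)
  ...   | inj₁ has = inj₁ (update-keeps-defectorNeighbour D x has)
  ...   | inj₂ N⊆x∷pending with find-or-all-not D false (N v)
  ...     | inj₁ has = inj₁ (update-keeps-defectorNeighbour D x has)
  ...     | inj₂ all-coop with ⊆-∷⁻ _≟ᶠ_ N⊆x∷pending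
  ...       | inj₂ N⊆pending = inj₂ N⊆pending
  ...       | inj₁ vx =
    let weak = isolatedDefector-neighbour-weak D (trans (sym unchanged) d′v , all-coop) vx
    in inj₁ (x , vx , trans (update-weak D x weak) (cong not (all-coop x vx)))

  updateAll-isolationPending : ∀ (D : Config n) ord → IsolationPending D ord →
    IsolationPending (updateAll T D ord) []
  updateAll-isolationPending D []        invariant = invariant
  updateAll-isolationPending D (x ∷ ord) invariant =
    updateAll-isolationPending (update T D x) ord (update-keeps-isolationPending D x ord invariant)

  weak-isolationPending : ∀ (D : Config n) ord → (∀ v → (v ∈ ord) ⇔ Weak T D v) → IsolationPending D ord
  weak-isolationPending D ord ord⇔weak v dv with find-or-all-not D false (N v)
  ... | inj₁ has     = inj₁ has
  ... | inj₂ all-coop = inj₂ λ {u} vu →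
    Equivalence.from (ord⇔weak u) (isolatedDefector-neighbour-weak D (dv , all-coop) vu)

  nothing-pending⇒no-isolatedDefector : ∀ (D : Config n) → IsolationPending D [] →
    ∀ v → ¬ IsolatedDefector D v
  nothing-pending⇒no-isolatedDefector D invariant v (dv , all-coop) with invariant v dv
  ... | inj₁ (u , vu , du) = false≢true (trans (sym du) (all-coop u vu))
  ... | inj₂ N⊆[]          with N⊆[] (here refl)
  ...   | ()

  pdStep-no-isolatedDefector : ∀ {C C′ : Config n} → PDStep T C C′ → ∀ v → ¬ IsolatedDefector C′ v
  pdStep-no-isolatedDefector {C} {C′} (_ , ord , _ , ord⇔weak , C′≗) v (c′v , all-coop) =
    nothing-pending⇒no-isolatedDefector (updateAll T C ord)
      (updateAll-isolationPending C ord (weak-isolationPending C ord ord⇔weak))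
      v (trans (sym (C′≗ v)) c′v , λ u vu → trans (sym (C′≗ u)) (all-coop u vu))

lemma4p1 : (T : ℚ) → 1ℚ <ℚ T → T <ℚ (+ 4 / 3) →
    (n : ℕ) → 3 ≤ n →
    (C : ℕ → Config n) → (m : ℕ) →
    (∀ t → t < m → PDStep T (C t) (C (suc t))) →
    ∀ t → t ≤ m →
      (∀ v → C t v ≡ false → ¬ Weak T (C t) v)
      × (∀ v → C t v ≡ true → Weak T (C t) v →
           IsolatedCooperator (C t) v
           ⊎ (∃ λ u → Adj v u × IsolatedDefector (C t) u)
           ⊎ (∃ λ u → Adj v u × C t u ≡ true × (∃ λ w → Adj u w × C t w ≡ false)))
      × (t < m → ∀ v → ¬ IsolatedDefector (C (suc t)) v)
lemma4p1 T 1<T T<4/3 n _ C m steps t _ =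
    (λ v → defector-not-weak (C t) {v})
  , (λ v → weak-cooperator-neighbourhood T<2 (C t) {v})
  , (λ t<m → pdStep-no-isolatedDefector (steps t t<m))
  where
  open PD T 1<T {n}
  T<2 : T <ℚ 1ℚ + 1ℚ
  T<2 = <-trans T<4/3 (toWitness {a? = + 4 / 3 <? 1ℚ + 1ℚ} _)
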